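{- There is an algorithm that, given integers $a_1,\dots,a_n \geq 1$ such that $a_{i+1}/a_i$ is an integer for all $i<n$, and integer intervals $R_1=[b_1,B_1],\dots,R_n=[b_n,B_n]$, decides in time $\mathcal{O}(n^2)$ whether there exists an integer $s \geq 0$ such that for every $i=1,\dots,n$ there is some $r_i\in R_i$ with $s\equiv r_i \pmod{a_i}$.
   Context: This is the feasibility problem of Fuzzy Simultaneous Congruences (FSC) with harmonic divisors. Running time counts arithmetic operations on the input numbers. -}

module Defs where

-- Model of computation: algebraic decision trees over the input numbers.
-- An algorithm is a program that is *parametric* in an abstract number type X;
-- the only way to obtain or inspect values of type X is via the nodes below,
-- each of which is one arithmetic operation on numbers (cost 1).
-- Control flow may depend only on the results of comparisons (and on n).
-- Running time = number of arithmetic operations/comparisons executed.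

open import Data.Nat using (ℕ; zero; suc; _≤_) renaming (_+_ to _+ℕ_; _*_ to _*ℕ_)
open import Data.Integer using (ℤ; +_; -[1+_]; _+_; _-_; _*_; +0)
import Data.Integer as ℤ
open import Data.Integer.DivMod using (_/_; _%_)
open import Data.Integer.Divisibility using (_∣_)
open import Data.Bool using (Bool; true; false; T)
open import Data.Fin using (Fin; toℕ)
open import Data.Product using (_×_; _,_; Σ; ∃; ∃-syntax)
open import Relation.Binary.PropositionalEquality using (_≡_)
open import Relation.Nullary.Decidable using (⌊_⌋)

data Op : Set where
  add sub mul quot rem : Op

-- total floor division / remainder (division by 0 yields quotient 0, remainder = dividend)
divℤ : ℤ → ℤ → ℤ
divℤ a (+ zero)    = +0
divℤ a d@(+ suc _) = a / d
divℤ a d@(-[1+ _ ]) = a / d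

modℤ : ℤ → ℤ → ℤ
modℤ a (+ zero)    = a
modℤ a d@(+ suc _) = + (a % d)
modℤ a d@(-[1+ _ ]) = + (a % d)

evalOp : Op → ℤ → ℤ → ℤ
evalOp add  x y = x + y
evalOp sub  x y = x - y
evalOp mul  x y = x * y
evalOp quot x y = divℤ x y
evalOp rem  x y = modℤ x y

data Prog (X : Set) (A : Set) : Set where
  ret   : A → Prog X A
  const : ℤ → (X → Prog X A) → Prog X A
  arith : Op → X → X → (X → Prog X A) → Prog X A
  leq   : X → X → (Bool → Prog X A) → Prog X A

run : {A : Set} → Prog ℤ A → A × ℕ
run (ret a) = a , 0
run (const c k) with run (k c)
... | a , t = a , suc t
run (arith o x y k) with run (k (evalOp o x y))
... | a , t = a , suc t
run (leq x y k) with run (k ⌊ x ℤ.≤? y ⌋)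
... | a , t = a , suc t

result : {A : Set} → Prog ℤ A → A
result p = Data.Product.proj₁ (run p)

cost : {A : Set} → Prog ℤ A → ℕ
cost p = Data.Product.proj₂ (run p)

-- An FSC algorithm: for every n, a program parametric in the number type,
-- taking a₁..aₙ, b₁..bₙ, B₁..Bₙ as input.
FSCAlgorithm : Set₁
FSCAlgorithm = (n : ℕ) → {X : Set} → (Fin n → X) → (Fin n → X) → (Fin n → X) → Prog X Bool

HarmonicDivisors : (n : ℕ) → (Fin n → ℤ) → Set
HarmonicDivisors n a =
  ((i : Fin n) → ℤ.+ 1 ℤ.≤ a i) ×
  ((i j : Fin n) → toℕ j ≡ suc (toℕ i) → a i ∣ a j)

FSCFeasible : (n : ℕ) → (a b B : Fin n → ℤ) → Set
FSCFeasible n a b B =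
  ∃[ s ] (+0 ℤ.≤ s ×
    ((i : Fin n) → ∃[ r ] (b i ℤ.≤ r × r ℤ.≤ B i × a i ∣ (s - r))))

-- Let P be the set of integers satisfying the congruences processed so far and
-- next(L) = min {s ∈ P | s ≥ L}. Since a₁ ∣ a₂ ∣ …, P is periodic modulo the
-- modulus aᵢ of the next congruence, so P meets Rᵢ + aᵢℤ iff next(bᵢ) ≤ Bᵢ, and
-- the next function of P ∩ (Rᵢ + aᵢℤ) is computed from that of P with a constant
-- number of extra operations. Running the i-th next function thus costs O(i)
-- operations, and n rounds cost O(n²); at the end next(0) is a witness s ≥ 0.
module Submission where

open import Defs
open import Data.Nat as ℕ using (ℕ; zero; suc; z≤n; s≤s)
import Data.Nat.Properties as ℕ
open import Data.Nat.Tactic.RingSolver using (solve-∀)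
open import Data.Integer
  using (ℤ; +_; -[1+_]; _+_; _-_; _*_; -_; 0ℤ; 1ℤ; _≤_; _<_; _≤?_; +≤+; +<+)
open import Data.Integer.Properties
  using (≤-refl; ≤-trans; <⇒≤; ≰⇒>; i≤j⇒0≤j-i; 0≤i-j⇒j≤i; i<j⇒suc[i]≤j; suc[i]≤j⇒i<j;
         +-mono-≤; +-monoʳ-≤; +-monoˡ-≤; +-minus-telescope; pos-*; drop‿-<-)
open import Data.Integer.DivMod using (_/_; _%_; n%d<d; a≡a%n+[a/n]*n)
open import Data.Integer.Tactic.RingSolver using (solve)
open import Data.Integer.Divisibility.Signed
  using (_∣_; divides; ∣-refl; ∣-trans; ∣m∣n⇒∣m+n; ∣m∣n⇒∣m-n; ∣m⇒∣-m; ∣ᵤ⇒∣; ∣⇒∣ᵤ)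
open import Data.Bool using (Bool; true; false; T; if_then_else_; _∧_)
open import Data.Bool.Properties using (if-float)
open import Data.Empty using (⊥-elim)
open import Data.Fin using (Fin; zero; suc)
open import Data.List using ([]; _∷_)
open import Data.Product using (Σ; _×_; _,_; proj₁; map₂; ∃-syntax)
open import Data.Unit using (tt)
open import Data.Vec.Functional using (head; tail)
open import Function using (_∘_)
open import Function.Bundles using (_⇔_; mk⇔)
import Function.Properties.Equivalence as ⇔
open import Level using (0ℓ)
open import Relation.Nullary using (yes; no; ¬_)
open import Relation.Nullary.Decidable using (⌊_⌋)
open import Relation.Unary using (Pred; _∩_; U)
open import Relation.Binary.PropositionalEquality
  using (_≡_; refl; sym; trans; cong; subst; module ≡-Reasoning)

-- Linear inequalities are proved by exhibiting y − x as an expression e already known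
-- to be nonnegative; the identity e ≡ y − x is left to the ring solver.
≤-via : ∀ {x y} (e : ℤ) → 0ℤ ≤ e → e ≡ y - x → x ≤ y
≤-via e 0≤e refl = 0≤i-j⇒j≤i 0≤e

<-via : ∀ {x y} (e : ℤ) → 0ℤ ≤ e → e ≡ y - (1ℤ + x) → x < y
<-via e 0≤e eq = suc[i]≤j⇒i<j (≤-via e 0≤e eq)

i<j⇒0≤j-[1+i] : ∀ {i j} → i < j → 0ℤ ≤ j - (1ℤ + i)
i<j⇒0≤j-[1+i] i<j = i≤j⇒0≤j-i (i<j⇒suc[i]≤j i<j)

[i+j]-i≡j : ∀ i j → (i + j) - i ≡ j
[i+j]-i≡j i j = solve (i ∷ j ∷ [])

-i<j∧i∣j⇒0≤j : ∀ {i j} → 1ℤ ≤ i → - i < j → i ∣ j → 0ℤ ≤ j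
-i<j∧i∣j⇒0≤j {+ suc k} _ _ (divides (+ n) refl) = subst (0ℤ ≤_) (pos-* n (suc k)) (+≤+ z≤n)
-i<j∧i∣j⇒0≤j {+ suc k} _ -i<j (divides -[1+ n ] refl) = ⊥-elim (ℕ.m+n≮m k _ (drop‿-<- -i<j))
-i<j∧i∣j⇒0≤j {+ zero} (+≤+ ())

modℤ-nonNeg : ∀ x {a} → 1ℤ ≤ a → 0ℤ ≤ modℤ x a
modℤ-nonNeg x {+ suc k} _ = +≤+ z≤n
modℤ-nonNeg x {+ zero} (+≤+ ())

modℤ-< : ∀ x {a} → 1ℤ ≤ a → modℤ x a < a
modℤ-< x {+ suc k} _ = +<+ (n%d<d x (+ suc k))
modℤ-< x {+ zero} (+≤+ ())

modℤ-∣ : ∀ x {a} → 1ℤ ≤ a → a ∣ x - modℤ x a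
modℤ-∣ x {+ zero} (+≤+ ())
modℤ-∣ x {a@(+ suc k)} _ = divides (x / a) (begin
    x - r              ≡⟨ cong (_- r) (a≡a%n+[a/n]*n x a) ⟩
    (r + q * a) - r    ≡⟨ [i+j]-i≡j r (q * a) ⟩
    q * a              ∎)
  where
    open ≡-Reasoning
    r = + (x % a)
    q = x / a

∣-respʳ : ∀ {i j k} → i ∣ j → j ≡ k → i ∣ k
∣-respʳ i∣j refl = i∣j

Window : ℤ → ℤ → ℤ → Pred ℤ 0ℓ
Window a b B x = ∃[ r ] (b ≤ r × r ≤ B × a ∣ x - r)

Periodic : ℤ → Pred ℤ 0ℓ → Set
Periodic a P = ∀ x y → a ∣ y - x → P x → P y

window-periodic : ∀ {a b B} → Periodic a (Window a b B)
window-periodic {a} x y a∣y-x (r , b≤r , r≤B , a∣x-r) =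
  r , b≤r , r≤B , subst (a ∣_) (+-minus-telescope y x r) (∣m∣n⇒∣m+n a∣y-x a∣x-r)

periodic-∩ : ∀ {a P Q} → Periodic a P → Periodic a Q → Periodic a (P ∩ Q)
periodic-∩ periodicP periodicQ x y a∣y-x (Px , Qx) = periodicP x y a∣y-x Px , periodicQ x y a∣y-x Qx

periodic-∣ : ∀ {a c P} → a ∣ c → Periodic a P → Periodic c P
periodic-∣ a∣c periodic x y c∣y-x = periodic x y (∣-trans a∣c c∣y-x)

window-intro : ∀ {a b B t x} → a ∣ t - b → t ≤ x → x ≤ t + (B - b) → Window a b B x
window-intro {a} {b} {B} {t} {x} a∣t-b t≤x x≤t+w =
  x - (t - b) ,
  ≤-via (x - t) (i≤j⇒0≤j-i t≤x) (solve (x ∷ t ∷ b ∷ [])) ,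
  ≤-via ((t + (B - b)) - x) (i≤j⇒0≤j-i x≤t+w) (solve (x ∷ t ∷ b ∷ B ∷ [])) ,
  ∣-respʳ a∣t-b (solve (x ∷ t ∷ b ∷ []))

window-bound : ∀ {a b B t x} → 1ℤ ≤ a → a ∣ t - b → t ≤ x → x < t + a → Window a b B x →
               x ≤ t + (B - b)
window-bound {a} {b} {B} {t} {x} 1≤a a∣t-b t≤x x<t+a (r , b≤r , r≤B , a∣x-r) =
  ≤-via (((r - b) - (x - t)) + (B - r)) (+-mono-≤ 0≤d (i≤j⇒0≤j-i r≤B))
        (solve (r ∷ b ∷ x ∷ t ∷ B ∷ []))
  where
    -a<d : - a < (r - b) - (x - t)
    -a<d = <-via ((r - b) + ((t + a) - (1ℤ + x)))
                 (+-mono-≤ (i≤j⇒0≤j-i b≤r) (i<j⇒0≤j-[1+i] x<t+a)) (solve (r ∷ b ∷ t ∷ a ∷ x ∷ []))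
    a∣d : a ∣ (r - b) - (x - t)
    a∣d = ∣-respʳ (∣m∣n⇒∣m-n a∣t-b a∣x-r) (solve (t ∷ b ∷ x ∷ r ∷ []))
    0≤d : 0ℤ ≤ (r - b) - (x - t)
    0≤d = -i<j∧i∣j⇒0≤j 1≤a -a<d a∣d

record LeastAbove (P : Pred ℤ 0ℓ) (L y : ℤ) : Set where
  field
    above   : L ≤ y
    member  : P y
    minimal : ∀ {x} → L ≤ x → P x → y ≤ x

IsNext : Pred ℤ 0ℓ → (ℤ → ℤ) → Set
IsNext P next = ∀ L → LeastAbove P L (next L)

LeastAbove-∩ : ∀ {P Q L y} → LeastAbove P L y → Q y → LeastAbove (P ∩ Q) L y
LeastAbove-∩ least Qy = record
  { above   = above
  ; member  = member , Qy
  ; minimal = λ L≤x (Px , _) → minimal L≤x Px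
  }
  where open LeastAbove least

LeastAbove-lower : ∀ {P L M y} → L ≤ M → (∀ {x} → L ≤ x → x < M → ¬ P x) →
                   LeastAbove P M y → LeastAbove P L y
LeastAbove-lower {P} {L} {M} {y} L≤M gap least = record
  { above   = ≤-trans L≤M above
  ; member  = member
  ; minimal = minimal′
  }
  where
    open LeastAbove least
    minimal′ : ∀ {x} → L ≤ x → P x → y ≤ x
    minimal′ {x} L≤x Px with M ≤? x
    ... | yes M≤x = minimal M≤x Px
    ... | no  M≰x = ⊥-elim (gap L≤x (≰⇒> M≰x) Px)

LeastAbove-shift : ∀ {P a b y t} → Periodic a P → LeastAbove P b y → a ∣ t - b →
                   LeastAbove P t (t + (y - b))
LeastAbove-shift {P} {a} {b} {y} {t} periodic least a∣t-b = record
  { above   = ≤-via (y - b) (i≤j⇒0≤j-i above) (solve (t ∷ y ∷ b ∷ []))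
  ; member  = periodic y (t + (y - b)) (∣-respʳ a∣t-b (solve (t ∷ b ∷ y ∷ []))) member
  ; minimal = minimal′
  }
  where
    open LeastAbove least
    minimal′ : ∀ {x} → t ≤ x → P x → t + (y - b) ≤ x
    minimal′ {x} t≤x Px = ≤-via (x - (t - b) - y) (i≤j⇒0≤j-i y≤x′) (solve (x ∷ t ∷ b ∷ y ∷ []))
      where
        y≤x′ : y ≤ x - (t - b)
        y≤x′ = minimal (≤-via (x - t) (i≤j⇒0≤j-i t≤x) (solve (x ∷ t ∷ b ∷ [])))
                       (periodic x (x - (t - b)) (∣-respʳ (∣m⇒∣-m a∣t-b) (solve (t ∷ b ∷ x ∷ []))) Px)

meetsWindow⇒next≤ : ∀ {P g a b B x} → Periodic a P → IsNext P g → (P ∩ Window a b B) x → g b ≤ B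
meetsWindow⇒next≤ {x = x} periodic next (Px , r , b≤r , r≤B , a∣x-r) =
  ≤-trans (LeastAbove.minimal (next _) b≤r Pr) r≤B
  where Pr = periodic x r (∣-respʳ (∣m⇒∣-m a∣x-r) (solve (x ∷ r ∷ []))) Px

id-isNext : IsNext U (λ L → L)
id-isNext L = record { above = ≤-refl ; member = tt ; minimal = λ L≤x _ → L≤x }

-- t₀ ≡ b (mod a) starts the period block containing L, which meets the window in
-- [t₀, t₀ + w]. Outside it, the answer is the least point of P from t₀ + a on,
-- which by periodicity is t₀ + a + D for D = g b − b.
nextWindow : (ℤ → ℤ) → (a b D w : ℤ) → ℤ → ℤ
nextWindow g a b D w L =
  if ⌊ q ≤? w ⌋ ∧ ⌊ g L ≤? t₀ + w ⌋ then g L else t₀ + a + D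
  where
    q  = modℤ (L - b) a
    t₀ = L - q

module _ {P : Pred ℤ 0ℓ} {g : ℤ → ℤ} {a b B : ℤ}
         (1≤a : 1ℤ ≤ a) (periodic : Periodic a P) (next : IsNext P g) (gb≤B : g b ≤ B) where

  module _ {L q : ℤ} (0≤q : 0ℤ ≤ q) (q<a : q < a) (a∣L-b-q : a ∣ (L - b) - q) where

    private
      a∣t₀-b : a ∣ (L - q) - b
      a∣t₀-b = ∣-respʳ a∣L-b-q (solve (L ∷ b ∷ q ∷ []))

      a∣t₁-b : a ∣ ((L - q) + a) - b
      a∣t₁-b = ∣-respʳ (∣m∣n⇒∣m+n a∣t₀-b ∣-refl) (solve (L ∷ q ∷ b ∷ a ∷ []))

      t₀≤L : L - q ≤ L
      t₀≤L = ≤-via q 0≤q (solve (L ∷ q ∷ []))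

      L<t₁ : L < (L - q) + a
      L<t₁ = <-via (a - (1ℤ + q)) (i<j⇒0≤j-[1+i] q<a) (solve (L ∷ q ∷ a ∷ []))

      inWindow⇒≤ : ∀ {x} → L ≤ x → x < (L - q) + a → Window a b B x → x ≤ (L - q) + (B - b)
      inWindow⇒≤ L≤x = window-bound 1≤a a∣t₀-b (≤-trans t₀≤L L≤x)

      fromNextBlock : (∀ {x} → L ≤ x → x < (L - q) + a → ¬ (P ∩ Window a b B) x) →
                      LeastAbove (P ∩ Window a b B) L ((L - q) + a + (g b - b))
      fromNextBlock gap = LeastAbove-lower (<⇒≤ L<t₁) gap
        (LeastAbove-∩ shifted (window-intro a∣t₁-b (LeastAbove.above shifted)
                                 (+-monoʳ-≤ ((L - q) + a) (+-monoˡ-≤ (- b) gb≤B))))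
        where shifted = LeastAbove-shift periodic (next b) a∣t₁-b

    leastAbove-nextWindow :
      LeastAbove (P ∩ Window a b B) L
        (if ⌊ q ≤? B - b ⌋ ∧ ⌊ g L ≤? (L - q) + (B - b) ⌋ then g L else (L - q) + a + (g b - b))
    leastAbove-nextWindow with q ≤? B - b | g L ≤? (L - q) + (B - b)
    ... | yes _ | yes gL≤t₀+w =
      LeastAbove-∩ (next L) (window-intro a∣t₀-b (≤-trans t₀≤L (LeastAbove.above (next L))) gL≤t₀+w)
    ... | yes _ | no gL≰t₀+w = fromNextBlock λ L≤x x<t₁ (Px , Wx) →
      gL≰t₀+w (≤-trans (LeastAbove.minimal (next L) L≤x Px) (inWindow⇒≤ L≤x x<t₁ Wx))
    ... | no q≰w | _ = fromNextBlock λ {x} L≤x x<t₁ (_ , Wx) →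
      q≰w (≤-via (((L - q) + (B - b) - x) + (x - L))
                 (+-mono-≤ (i≤j⇒0≤j-i (inWindow⇒≤ L≤x x<t₁ Wx)) (i≤j⇒0≤j-i L≤x))
                 (solve (L ∷ q ∷ B ∷ b ∷ x ∷ [])))

  nextWindow-isNext : IsNext (P ∩ Window a b B) (nextWindow g a b (g b - b) (B - b))
  nextWindow-isNext L =
    leastAbove-nextWindow (modℤ-nonNeg (L - b) 1≤a) (modℤ-< (L - b) 1≤a) (modℤ-∣ (L - b) 1≤a)

Feasible : (n : ℕ) → (a b B : Fin n → ℤ) → Pred ℤ 0ℓ → Set
Feasible n a b B P = ∃[ s ] (0ℤ ≤ s × P s × ∀ i → Window (a i) (b i) (B i) s)

Feasible-suc : ∀ {n a b B P} →
  Feasible n (tail a) (tail b) (tail B) (P ∩ Window (head a) (head b) (head B)) ⇔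
  Feasible (suc n) a b B P
Feasible-suc = mk⇔
  (λ (s , 0≤s , (Ps , W₀s) , Ws) → s , 0≤s , Ps , λ { zero → W₀s ; (suc i) → Ws i })
  (λ (s , 0≤s , Ps , Ws) → s , 0≤s , (Ps , Ws zero) , Ws ∘ suc)

harmonic-tail : ∀ {n a} → HarmonicDivisors (suc n) a → HarmonicDivisors n (tail a)
harmonic-tail (positive , chain) = positive ∘ suc , λ i j j≡1+i → chain (suc i) (suc j) (cong suc j≡1+i)

harmonic-head∣ : ∀ {n a} → HarmonicDivisors (suc n) a → ∀ j → head a ∣ a j
harmonic-head∣ harmonic zero = ∣-refl
harmonic-head∣ {suc n} harmonic@(_ , chain) (suc j) =
  ∣-trans (∣ᵤ⇒∣ (chain zero (suc zero) refl)) (harmonic-head∣ (harmonic-tail harmonic) j)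

feasibleFrom : (n : ℕ) → (a b B : Fin n → ℤ) → (ℤ → ℤ) → Bool
feasibleFrom zero    a b B g = true
feasibleFrom (suc n) a b B g =
  if ⌊ g (head b) ≤? head B ⌋
    then feasibleFrom n (tail a) (tail b) (tail B)
           (nextWindow g (head a) (head b) (g (head b) - head b) (head B - head b))
    else false

feasibleFrom-correct : ∀ n {a b B P g} → HarmonicDivisors n a → (∀ i → Periodic (a i) P) → IsNext P g →
                       T (feasibleFrom n a b B g) ⇔ Feasible n a b B P
feasibleFrom-correct zero {g = g} _ _ next = mk⇔ (λ _ → g 0ℤ , above , member , λ ()) (λ _ → tt)
  where open LeastAbove (next 0ℤ)
feasibleFrom-correct (suc n) {a} {b} {B} {g = g} harmonic periodic next with g (head b) ≤? head B
... | yes gb≤B = ⇔.trans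
  (feasibleFrom-correct n (harmonic-tail harmonic)
    (λ i → periodic-∩ (periodic (suc i)) (periodic-∣ (harmonic-head∣ harmonic (suc i)) window-periodic))
    (nextWindow-isNext (proj₁ harmonic zero) (periodic zero) next gb≤B))
  Feasible-suc
... | no  gb≰B = mk⇔ (λ ()) λ (_ , _ , Ps , Ws) →
  gb≰B (meetsWindow⇒next≤ (periodic zero) next (Ps , Ws zero))

-- A program computing a function g, in continuation-passing style since Prog has no
-- sequencing: nx L k behaves as k (g L).
NextProg : Set → Set
NextProg X = X → (X → Prog X Bool) → Prog X Bool

idNext : ∀ {X} → NextProg X
idNext L k = k L

windowNext : ∀ {X} → NextProg X → (a b D w : X) → NextProg X
windowNext nx a b D w L k =
  arith sub L b   λ L-b →
  arith rem L-b a λ q →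
  arith sub L q   λ t₀ →
  arith add t₀ a  λ t₁ →
  arith add t₁ D  λ z →
  leq q w         λ q≤w →
  if q≤w
    then (nx L λ y → arith add t₀ w λ t₀+w → leq y t₀+w λ y≤t₀+w → if y≤t₀+w then k y else k z)
    else k z

fsc : ∀ {X} (n : ℕ) → (a b B : Fin n → X) → NextProg X → Prog X Bool
fscStep : ∀ {X} (n : ℕ) → (a b B : Fin (suc n) → X) → NextProg X → X → Prog X Bool

fsc zero    a b B nx = ret true
fsc (suc n) a b B nx =
  nx (head b)    λ y →
  leq y (head B) λ y≤B →
  if y≤B then fscStep n a b B nx y else ret false

fscStep n a b B nx y =
  arith sub y (head b)        λ D →
  arith sub (head B) (head b) λ w →
  fsc n (tail a) (tail b) (tail B) (windowNext nx (head a) (head b) D w)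

record Computes (nx : NextProg ℤ) (g : ℤ → ℤ) : Set where
  field
    result-≡ : ∀ L k → result (nx L k) ≡ result (k (g L))

record HasOverhead (nx : NextProg ℤ) (g : ℤ → ℤ) (m : ℕ) : Set where
  field
    cost-≤ : ∀ L k → cost (nx L k) ℕ.≤ m ℕ.+ cost (k (g L))

open Computes
open HasOverhead

idNext-computes : Computes idNext (λ L → L)
idNext-computes .result-≡ L k = refl

idNext-overhead : HasOverhead idNext (λ L → L) 0
idNext-overhead .cost-≤ L k = ℕ.≤-refl

if-pull : ∀ {A B : Set} c (f : A → B) {x y} → (if c then f x else f y) ≡ f (if c then x else y)
if-pull c f = sym (if-float f c)

module _ {nx : NextProg ℤ} {g : ℤ → ℤ} {a b D w : ℤ} where

  windowNext-computes : Computes nx g → Computes (windowNext nx a b D w) (nextWindow g a b D w)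
  windowNext-computes computes .result-≡ L k with ⌊ modℤ (L - b) a ≤? w ⌋
  ... | false = refl
  ... | true  = trans (result-≡ computes L _) (cong result (if-pull ⌊ g L ≤? t₀ + w ⌋ k))
    where t₀ = L - modℤ (L - b) a

  windowNext-overhead : ∀ {m} → HasOverhead nx g m →
                        HasOverhead (windowNext nx a b D w) (nextWindow g a b D w) (m ℕ.+ 8)
  windowNext-overhead {m} overhead .cost-≤ L k with ⌊ modℤ (L - b) a ≤? w ⌋
  ... | false = ℕ.+-monoˡ-≤ (cost (k z)) (ℕ.≤-trans (ℕ.m≤m+n 6 2) (ℕ.m≤n+m 8 m))
    where z = L - modℤ (L - b) a + a + D
  ... | true  = begin
    6 ℕ.+ cost (nx L _)
      ≤⟨ ℕ.+-monoʳ-≤ 6 (cost-≤ overhead L _) ⟩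
    6 ℕ.+ (m ℕ.+ (2 ℕ.+ cost (if c then k (g L) else k z)))
      ≡⟨ cong (λ x → 6 ℕ.+ (m ℕ.+ (2 ℕ.+ cost x))) (if-pull c k) ⟩
    6 ℕ.+ (m ℕ.+ (2 ℕ.+ cost (k (if c then g L else z))))
      ≡⟨ regroup m _ ⟩
    m ℕ.+ 8 ℕ.+ cost (k (if c then g L else z))
      ∎
    where
      open ℕ.≤-Reasoning
      t₀ = L - modℤ (L - b) a
      z = t₀ + a + D
      c = ⌊ g L ≤? t₀ + w ⌋
      regroup : ∀ m x → 6 ℕ.+ (m ℕ.+ (2 ℕ.+ x)) ≡ m ℕ.+ 8 ℕ.+ x
      regroup = solve-∀

fsc-computes : ∀ n {a b B nx g} → Computes nx g → result (fsc n a b B nx) ≡ feasibleFrom n a b B g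
fsc-computes zero    computes = refl
fsc-computes (suc n) {a} {b} {B} {nx} {g} computes = begin
  result (fsc (suc n) a b B nx)                          ≡⟨ result-≡ computes (head b) _ ⟩
  result (if c then fscStep n a b B nx (g (head b)) else ret false)
                                                         ≡⟨ if-float result c ⟩
  (if c then result (fscStep n a b B nx (g (head b))) else false)
                                                         ≡⟨ cong (if c then_else false)
                                                              (fsc-computes n (windowNext-computes computes)) ⟩
  feasibleFrom (suc n) a b B g                           ∎
  where
    open ≡-Reasoning
    c = ⌊ g (head b) ≤? head B ⌋

cost-if-ret : ∀ c (p : Prog ℤ Bool) {x} → cost (if c then p else ret x) ℕ.≤ cost p
cost-if-ret true  p = ℕ.≤-refl
cost-if-ret false p = z≤n

fsc-cost : ∀ n {a b B nx g m} → HasOverhead nx g m →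
           cost (fsc n a b B nx) ℕ.≤ m ℕ.* n ℕ.+ 8 ℕ.* (n ℕ.* n)
fsc-cost zero    overhead = z≤n
fsc-cost (suc n) {a} {b} {B} {nx} {g} {m} overhead = begin
  cost (fsc (suc n) a b B nx)                           ≤⟨ cost-≤ overhead (head b) _ ⟩
  m ℕ.+ suc (cost (if c then p else ret false))         ≤⟨ ℕ.+-monoʳ-≤ m (s≤s (cost-if-ret c p)) ⟩
  m ℕ.+ suc (cost p)                                    ≤⟨ ℕ.+-monoʳ-≤ m (s≤s (s≤s (s≤s
                                                             (fsc-cost n (windowNext-overhead overhead))))) ⟩
  m ℕ.+ (3 ℕ.+ ((m ℕ.+ 8) ℕ.* n ℕ.+ 8 ℕ.* (n ℕ.* n)))   ≤⟨ ℕ.m≤m+n _ (5 ℕ.+ 8 ℕ.* n) ⟩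
  m ℕ.+ (3 ℕ.+ ((m ℕ.+ 8) ℕ.* n ℕ.+ 8 ℕ.* (n ℕ.* n))) ℕ.+ (5 ℕ.+ 8 ℕ.* n)
                                                        ≡⟨ expand m n ⟩
  m ℕ.* suc n ℕ.+ 8 ℕ.* (suc n ℕ.* suc n)              ∎
  where
    open ℕ.≤-Reasoning
    c = ⌊ g (head b) ≤? head B ⌋
    p = fscStep n a b B nx (g (head b))
    expand : ∀ m n → m ℕ.+ (3 ℕ.+ ((m ℕ.+ 8) ℕ.* n ℕ.+ 8 ℕ.* (n ℕ.* n))) ℕ.+ (5 ℕ.+ 8 ℕ.* n)
                     ≡ m ℕ.* suc n ℕ.+ 8 ℕ.* (suc n ℕ.* suc n)
    expand = solve-∀

Feasible-U⇔FSCFeasible : ∀ {n a b B} → Feasible n a b B U ⇔ FSCFeasible n a b B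
Feasible-U⇔FSCFeasible = mk⇔
  (λ (s , 0≤s , _ , Ws) → s , 0≤s , map₂ (map₂ (map₂ ∣⇒∣ᵤ)) ∘ Ws)
  (λ (s , 0≤s , Ws) → s , 0≤s , tt , map₂ (map₂ (map₂ ∣ᵤ⇒∣)) ∘ Ws)

fscAlgorithm : FSCAlgorithm
fscAlgorithm n a b B = fsc n a b B idNext

theorem7 : Σ FSCAlgorithm λ alg → ∃[ c ] ∃[ N₀ ]
    ((n : ℕ) → (a b B : Fin n → ℤ) → HarmonicDivisors n a →
    (T (result (alg n a b B)) ⇔ FSCFeasible n a b B)
    × (N₀ ℕ.≤ n → cost (alg n a b B) ℕ.≤ c ℕ.* (n ℕ.* n)))
theorem7 = fscAlgorithm , 8 , 0 , λ n a b B harmonic →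
  correct n harmonic , λ _ → fsc-cost n idNext-overhead
  where
    correct : ∀ n {a b B} → HarmonicDivisors n a →
              T (result (fscAlgorithm n a b B)) ⇔ FSCFeasible n a b B
    correct n {a} {b} {B} harmonic =
      subst (λ v → T v ⇔ FSCFeasible n a b B) (sym (fsc-computes n idNext-computes))
        (⇔.trans (feasibleFrom-correct n harmonic (λ _ _ _ _ _ → tt) id-isNext)
                 Feasible-U⇔FSCFeasible)
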